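{- Let $b\ge 2$ and $n\ge b+1$ be integers, and let $\chi$ be an exact $b$-coloring of $[n]$. Then $[n]$ contains no rainbow solution of $y=x+b$ if and only if for each $\lambda\in[b]$ the $\lambda$-class $\mathcal{C}_{(y=x+b,\lambda)}=\{\lambda,\lambda+b,\lambda+2b,\dots\}\cap[n]$ is monochromatic. Furthermore, in this case, for distinct $\lambda_i,\lambda_j\in[b]$ the classes $\mathcal{C}_{(y=x+b,\lambda_i)}$ and $\mathcal{C}_{(y=x+b,\lambda_j)}$ have different colors.
   Context: $[n]=\{1,\dots,n\}$. An exact $b$-coloring of $[n]$ is a surjective map $\chi:[n]\to[b]$. A solution of $y=x+b$ in $[n]$ is a pair $(x_0,y_0)$ with $x_0,y_0\in[n]$ and $y_0=x_0+b$; it is rainbow if $\chi(x_0)\ne\chi(y_0)$. A set is monochromatic if all its elements receive the same color, and then its color is that common color. -}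

module Defs where

open import Data.Nat using (ℕ; _+_; _*_; _≤_)
open import Data.Product using (_×_; Σ; ∃; ∃-syntax)
open import Relation.Binary.PropositionalEquality using (_≡_; _≢_)
open import Relation.Nullary using (¬_)

InRange : ℕ → ℕ → Set
InRange n x = 1 ≤ x × x ≤ n

ExactColoring : ℕ → ℕ → (ℕ → ℕ) → Set
ExactColoring n b χ =
  (∀ x → InRange n x → InRange b (χ x)) ×
  (∀ c → InRange b c → ∃[ x ] (InRange n x × χ x ≡ c))

RainbowSolution : ℕ → ℕ → (ℕ → ℕ) → ℕ → ℕ → Set
RainbowSolution n b χ x y = InRange n x × InRange n y × y ≡ x + b × χ x ≢ χ y

NoRainbowSolution : ℕ → ℕ → (ℕ → ℕ) → Set
NoRainbowSolution n b χ = ∀ x y → ¬ RainbowSolution n b χ x y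

InClass : ℕ → ℕ → ℕ → ℕ → Set
InClass n b l x = InRange n x × ∃[ k ] (x ≡ l + k * b)

Monochromatic : (ℕ → ℕ) → (ℕ → Set) → Set
Monochromatic χ S = ∀ x y → S x → S y → χ x ≡ χ y

HasColor : (ℕ → ℕ) → (ℕ → Set) → ℕ → Set
HasColor χ S c = ∀ x → S x → χ x ≡ c

-- Every x ∈ [n] can be written x = r + q·b with r ∈ [b], so the classes of the residues r ∈ [b]
-- partition [n], and consecutive members of a class form exactly the solutions (x, x + b).
-- Hence no rainbow solution means χ is constant along each class, and conversely.
-- If two classes shared a color, then χ would take at most b − 1 values on the b residues,
-- yet every color of [b] is the color of some residue: a map from the b colors into the
-- b − 1 remaining residues with left inverse χ, contradicting the pigeonhole principle.
module Submission where

open import Defs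
open import Data.Nat using (ℕ; zero; suc; _+_; _*_; _∸_; _≤_; s≤s; z≤n; _≟_; NonZero)
open import Data.Nat.Properties using (+-assoc; +-comm; +-identityʳ; m≤m+n; m≤n+m; +-monoʳ-≤; ≤-trans; 1+n≰n; suc-injective)
open import Data.Nat.DivMod using (_%_; _/_; m≡m%n+[m/n]*n; m%n<n)
open import Data.Fin using (Fin; toℕ; fromℕ<; punchOut)
open import Data.Fin.Properties using (fromℕ<-injective; punchOut-injective; toℕ<n; toℕ-injective; injective⇒≤)
open import Data.Product using (_×_; _,_; proj₁; proj₂; ∃-syntax)
open import Function.Bundles using (_⇔_; mk⇔)
open import Relation.Nullary using (¬_; yes; no; contradiction)
open import Relation.Binary.PropositionalEquality

position : ∀ {b x} → InRange b x → Fin b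
position {x = suc x} (s≤s z≤n , x<b) = fromℕ< x<b

position-injective : ∀ {b x y} (rx : InRange b x) (ry : InRange b y) →
  position rx ≡ position ry → x ≡ y
position-injective {x = suc x} {suc y} (s≤s z≤n , x<b) (s≤s z≤n , y<b) eq =
  cong suc (fromℕ<-injective x y x<b y<b eq)

¬onto-from-[b]-minus-point : ∀ {b} p (χ : ℕ → ℕ) → InRange b p →
  ¬ (∀ c → InRange b c → ∃[ t ] (InRange b t × t ≢ p × χ t ≡ c))
¬onto-from-[b]-minus-point {zero} (suc p) χ (_ , ())
¬onto-from-[b]-minus-point {suc m} p χ rp onto = 1+n≰n (injective⇒≤ f-injective)
  where
  color : Fin (suc m) → ℕ
  color i = suc (toℕ i)

  color-inRange : ∀ i → InRange (suc m) (color i)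
  color-inRange i = s≤s z≤n , toℕ<n i

  s : Fin (suc m) → ℕ
  s i = proj₁ (onto (color i) (color-inRange i))

  s-inRange : ∀ i → InRange (suc m) (s i)
  s-inRange i = proj₁ (proj₂ (onto (color i) (color-inRange i)))

  p≢s : ∀ i → position rp ≢ position (s-inRange i)
  p≢s i eq = proj₁ (proj₂ (proj₂ (onto (color i) (color-inRange i))))
    (sym (position-injective rp (s-inRange i) eq))

  χ∘s≡color : ∀ i → χ (s i) ≡ color i
  χ∘s≡color i = proj₂ (proj₂ (proj₂ (onto (color i) (color-inRange i))))

  f : Fin (suc m) → Fin m
  f i = punchOut (p≢s i)

  f-injective : ∀ {i j} → f i ≡ f j → i ≡ j
  f-injective {i} {j} eq = toℕ-injective (suc-injective (begin
    color i              ≡⟨ sym (χ∘s≡color i) ⟩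
    χ (s i)               ≡⟨ cong χ (position-injective (s-inRange i) (s-inRange j)
                               (punchOut-injective (p≢s i) (p≢s j) eq)) ⟩
    χ (s j)               ≡⟨ χ∘s≡color j ⟩
    color j              ∎))
    where open ≡-Reasoning

module _ (b : ℕ) .{{_ : NonZero b}} where

  residue : ℕ → ℕ
  residue x = suc ((x ∸ 1) % b)

  quotient : ℕ → ℕ
  quotient x = (x ∸ 1) / b

  residue-inRange : ∀ x → InRange b (residue x)
  residue-inRange x = s≤s z≤n , m%n<n (x ∸ 1) b

  ≡residue+quotient*b : ∀ {x} → 1 ≤ x → x ≡ residue x + quotient x * b
  ≡residue+quotient*b {suc x} _ = cong suc (m≡m%n+[m/n]*n x b)

  inClass-residue : ∀ {n x} → InRange n x → InClass n b (residue x) x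
  inClass-residue {x = x} rx = rx , quotient x , ≡residue+quotient*b (proj₁ rx)

  inClass-self : ∀ {n l} → InRange n l → InClass n b l l
  inClass-self {l = l} rl = rl , 0 , sym (+-identityʳ l)

  +*b≤+suc*b : ∀ l k → l + k * b ≤ l + suc k * b
  +*b≤+suc*b l k = +-monoʳ-≤ l (m≤n+m (k * b) b)

  +suc*b≡+*b+b : ∀ l k → l + suc k * b ≡ l + k * b + b
  +suc*b≡+*b+b l k = trans (cong (l +_) (+-comm b (k * b))) (sym (+-assoc l (k * b) b))

  module _ {n : ℕ} {χ : ℕ → ℕ} where

    noRainbow⇒χ-constant-along-class : NoRainbowSolution n b χ → ∀ {l} → 1 ≤ l →
      ∀ k → l + k * b ≤ n → χ (l + k * b) ≡ χ l
    noRainbow⇒χ-constant-along-class nr {l} 1≤l zero _ = cong χ (+-identityʳ l)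
    noRainbow⇒χ-constant-along-class nr {l} 1≤l (suc k) ≤n
      with χ (l + k * b) ≟ χ (l + suc k * b)
    ... | yes eq = trans (sym eq)
      (noRainbow⇒χ-constant-along-class nr 1≤l k (≤-trans (+*b≤+suc*b l k) ≤n))
    ... | no neq = contradiction rainbow (nr (l + k * b) (l + suc k * b))
      where
      rainbow : RainbowSolution n b χ (l + k * b) (l + suc k * b)
      rainbow = (≤-trans 1≤l (m≤m+n l _) , ≤-trans (+*b≤+suc*b l k) ≤n)
              , (≤-trans 1≤l (m≤m+n l _) , ≤n)
              , +suc*b≡+*b+b l k
              , neq

    noRainbow⇒χ≡classColor : NoRainbowSolution n b χ → ∀ {l x} → 1 ≤ l →
      InClass n b l x → χ x ≡ χ l
    noRainbow⇒χ≡classColor nr 1≤l ((_ , x≤n) , k , refl) =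
      noRainbow⇒χ-constant-along-class nr 1≤l k x≤n

    noRainbow⇒classes-monochromatic : NoRainbowSolution n b χ →
      ∀ l → InRange b l → Monochromatic χ (InClass n b l)
    noRainbow⇒classes-monochromatic nr l (1≤l , _) x y x∈l y∈l =
      trans (noRainbow⇒χ≡classColor nr 1≤l x∈l) (sym (noRainbow⇒χ≡classColor nr 1≤l y∈l))

    classes-monochromatic⇒noRainbow : (∀ l → InRange b l → Monochromatic χ (InClass n b l)) →
      NoRainbowSolution n b χ
    classes-monochromatic⇒noRainbow mono x y (rx , ry , refl , χx≢χy) =
      χx≢χy (mono (residue x) (residue-inRange x) x (x + b) (inClass-residue rx) x+b∈class)
      where
      x+b∈class : InClass n b (residue x) (x + b)
      x+b∈class = ry , suc (quotient x) , (begin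
        x + b                                   ≡⟨ cong (_+ b) (≡residue+quotient*b (proj₁ rx)) ⟩
        residue x + quotient x * b + b          ≡⟨ sym (+suc*b≡+*b+b (residue x) (quotient x)) ⟩
        residue x + suc (quotient x) * b        ∎)
        where open ≡-Reasoning

    noRainbow⇒distinct-class-colors : ExactColoring n b χ → NoRainbowSolution n b χ →
      ∀ {l₁ l₂} → InRange b l₁ → InRange b l₂ → l₁ ≢ l₂ → χ l₁ ≢ χ l₂
    noRainbow⇒distinct-class-colors (_ , surjective) nr {l₁} {l₂} rl₁ rl₂ l₁≢l₂ χl₁≡χl₂ =
      ¬onto-from-[b]-minus-point l₂ χ rl₂ onto
      where
      χ≡χ∘residue : ∀ {x} → InRange n x → χ x ≡ χ (residue x)
      χ≡χ∘residue {x} rx = noRainbow⇒χ≡classColor nr (proj₁ (residue-inRange x)) (inClass-residue rx)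

      onto : ∀ c → InRange b c → ∃[ t ] (InRange b t × t ≢ l₂ × χ t ≡ c)
      onto c rc with surjective c rc
      ... | x , rx , refl with residue x ≟ l₂
      ...   | no r≢l₂ = residue x , residue-inRange x , r≢l₂ , sym (χ≡χ∘residue rx)
      ...   | yes refl = l₁ , rl₁ , l₁≢l₂ , trans χl₁≡χl₂ (sym (χ≡χ∘residue rx))

mainTheorem2 : (b n : ℕ) → 2 ≤ b → b + 1 ≤ n → (χ : ℕ → ℕ) → ExactColoring n b χ →
    (NoRainbowSolution n b χ ⇔ (∀ l → InRange b l → Monochromatic χ (InClass n b l))) ×
    (NoRainbowSolution n b χ → ∀ l₁ l₂ → InRange b l₁ → InRange b l₂ → l₁ ≢ l₂ →
      ∀ c₁ c₂ → HasColor χ (InClass n b l₁) c₁ → HasColor χ (InClass n b l₂) c₂ → c₁ ≢ c₂)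
mainTheorem2 b@(suc _) n _ b+1≤n χ coloring =
  mk⇔ (noRainbow⇒classes-monochromatic b) (classes-monochromatic⇒noRainbow b) ,
  λ nr l₁ l₂ rl₁ rl₂ l₁≢l₂ c₁ c₂ l₁-colored l₂-colored c₁≡c₂ →
    noRainbow⇒distinct-class-colors b coloring nr rl₁ rl₂ l₁≢l₂ (begin
      χ l₁  ≡⟨ l₁-colored l₁ (inClass-self b (inRange-n rl₁)) ⟩
      c₁    ≡⟨ c₁≡c₂ ⟩
      c₂    ≡⟨ sym (l₂-colored l₂ (inClass-self b (inRange-n rl₂))) ⟩
      χ l₂  ∎)
  where
  open ≡-Reasoning

  b≤n : b ≤ n
  b≤n = ≤-trans (m≤m+n b 1) b+1≤n

  inRange-n : ∀ {l} → InRange b l → InRange n l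
  inRange-n (1≤l , l≤b) = 1≤l , ≤-trans l≤b b≤n
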